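{- Let $G=(V,E,w)$ be a graph with non-negative edge-weights, let $s\in V$ and let $C$ be a cycle of $G$. Then the minimum $t_0\ge 0$ such that $\mathtt{HBD}(G,s,t_0)$ detects a cycle satisfies $t_0\le dist(s,C)+w(C)$.
   Context: Graphs are finite, simple, connected and undirected. $w(C)$ is the sum of the weights of the edges of $C$; $dist(s,C)=\min_{x\in V(C)} dist(s,x)$ where $dist$ is the weighted shortest-path distance. The procedure $\mathtt{HBD}(G,s,t)$ is the following truncated Dijkstra search: set $d(v)=\infty$ for all $v$, $d(s)=0$, and a priority queue $Q=\{s\}$. While $Q\ne\emptyset$, extract $u\in Q$ with minimum $d(u)$ and scan the edges $uv$ incident to $u$ (other than the edge through which $u$ was discovered) in non-decreasing order of weight as long as $d(u)+w_{uv}\le t$; for each such edge: if $d(v)\neq\infty$, report a cycle and stop; otherwise set $d(v)=d(u)+w_{uv}$ and insert $v$ into $Q$. The procedure "detects a cycle" if it stops by reporting a cycle.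
   Formalization: The edge weights, and with them dist(s,C), w(C) and the threshold t₀, are rational rather than real. -}

module Defs where

open import Data.Nat using (ℕ)
open import Data.Fin using (Fin; _≟_)
open import Data.Rational using (ℚ; 0ℚ; _+_; _≤_; _<_)
open import Data.Maybe using (Maybe; just; nothing; fromMaybe)
open import Data.List using (List; []; _∷_; _++_; [_]; zip; map; foldr; length; filter)
open import Data.List.Membership.Propositional using (_∈_)
open import Data.List.Relation.Unary.All using (All)
open import Data.List.Relation.Unary.Linked using (Linked)
open import Data.List.Relation.Unary.Unique.Propositional using (Unique)
open import Data.Product using (Σ; ∃; ∃-syntax; _×_; _,_; proj₁; proj₂)
open import Data.Bool using (if_then_else_)
open import Relation.Nullary using (¬_; ¬?; does)
open import Relation.Binary.PropositionalEquality using (_≡_; _≢_)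
open import Function.Bundles using (_⇔_)

-- W x y = nothing : no edge;  W x y = just w : edge xy of weight w.

data Walk {n : ℕ} (W : Fin n → Fin n → Maybe ℚ) : Fin n → Fin n → ℚ → Set where
  here : ∀ {x} → Walk W x x 0ℚ
  step : ∀ {x y z w c} → W x y ≡ just w → Walk W y z c → Walk W x z (w + c)

record Graph (n : ℕ) : Set where
  field
    W         : Fin n → Fin n → Maybe ℚ
    loopless  : ∀ x → W x x ≡ nothing
    symmetric : ∀ x y → W x y ≡ W y x
    nonneg    : ∀ x y w → W x y ≡ just w → 0ℚ ≤ w
    connected : ∀ x y → ∃[ c ] Walk W x y c
open Graph public

module _ {n : ℕ} (G : Graph n) where

  IsEdge : Fin n → Fin n → Set
  IsEdge x y = ∃[ w ] (W G x y ≡ just w)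

  -- weight of edge xy (only used on actual edges)
  wt : Fin n → Fin n → ℚ
  wt x y = fromMaybe 0ℚ (W G x y)

cyclePairs : ∀ {A : Set} → List A → List (A × A)
cyclePairs []       = []
cyclePairs (x ∷ xs) = zip (x ∷ xs) (xs ++ [ x ])

sumℚ : List ℚ → ℚ
sumℚ = foldr _+_ 0ℚ

record Cycle {n : ℕ} (G : Graph n) : Set where
  field
    verts    : List (Fin n)
    long     : 3 Data.Nat.≤ length verts
    distinct : Unique verts
    adjacent : All (λ p → IsEdge G (proj₁ p) (proj₂ p)) (cyclePairs verts)
open Cycle public

cycleWeight : ∀ {n} {G : Graph n} → Cycle G → ℚ
cycleWeight {G = G} C = sumℚ (map (λ p → wt G (proj₁ p) (proj₂ p)) (cyclePairs (verts C)))

IsDistToCycle : ∀ {n} (G : Graph n) → Fin n → Cycle G → ℚ → Set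
IsDistToCycle G s C δ =
  (∃[ x ] (x ∈ verts C × Walk (W G) s x δ)) ×
  (∀ x c → x ∈ verts C → Walk (W G) s x c → δ ≤ c)

-- The procedure HBD(G,s,t) as a (nondeterministic: ties in the priority
-- queue and among equal-weight edges are arbitrary) transition system.

update : ∀ {n} {A : Set} → (Fin n → A) → Fin n → A → Fin n → A
update f v a y = if does (y ≟ v) then a else f y

record State (n : ℕ) : Set where
  constructor mkState
  field
    d    : Fin n → Maybe ℚ              -- nothing = ∞
    par  : Fin n → Maybe (Fin n)        -- vertex through which v was discovered
    Q    : List (Fin n)
    scan : Maybe (Fin n × List (Fin n)) -- vertex being scanned, remaining neighbours
open State public

data Config (n : ℕ) : Set where
  running  : State n → Config n
  reported : Config n

initState : ∀ {n} → Fin n → State n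
initState s = mkState (update (λ _ → nothing) s (just 0ℚ)) (λ _ → nothing) [ s ] nothing

module _ {n : ℕ} (G : Graph n) (t : ℚ) where

  ScanList : State n → Fin n → List (Fin n) → Set
  ScanList st u L =
    Unique L ×
    (∀ v → (v ∈ L) ⇔ (IsEdge G u v × par st u ≢ just v)) ×
    Linked (λ a b → wt G u a ≤ wt G u b) L

  data Step : State n → Config n → Set where
    extract : ∀ {st u du L} →
      scan st ≡ nothing → u ∈ Q st → d st u ≡ just du →
      (∀ v → v ∈ Q st → ∃[ dv ] (d st v ≡ just dv × du ≤ dv)) →
      ScanList st u L →
      Step st (running (mkState (d st) (par st)
                 (filter (λ y → ¬? (y ≟ u)) (Q st)) (just (u , L))))
    scanDone : ∀ {st u} → scan st ≡ just (u , []) →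
      Step st (running (mkState (d st) (par st) (Q st) nothing))
    scanStop : ∀ {st u v L du} → scan st ≡ just (u , v ∷ L) → d st u ≡ just du →
      t < du + wt G u v →
      Step st (running (mkState (d st) (par st) (Q st) nothing))
    scanReport : ∀ {st u v L du dv} → scan st ≡ just (u , v ∷ L) → d st u ≡ just du →
      du + wt G u v ≤ t → d st v ≡ just dv →
      Step st reported
    scanNew : ∀ {st u v L du} → scan st ≡ just (u , v ∷ L) → d st u ≡ just du →
      du + wt G u v ≤ t → d st v ≡ nothing →
      Step st (running (mkState (update (d st) v (just (du + wt G u v)))
                                (update (par st) v (just u))
                                (v ∷ Q st) (just (u , L))))

  data AlwaysReports : Config n → Set where
    done : AlwaysReports reported
    next : ∀ {st} → (∃[ c ] Step st c) → (∀ c → Step st c → AlwaysReports c) →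
           AlwaysReports (running st)

-- HBD(G,s,t) detects a cycle (whatever the tie-breaking)
HBDDetects : ∀ {n} → Graph n → Fin n → ℚ → Set
HBDDetects G s t = AlwaysReports G t (running (initState s))

module Submission where

open import Defs
open import Data.Fin using (Fin)
open import Data.Rational using (ℚ; 0ℚ; _+_; _≤_)
open import Data.Product using (∃-syntax; _×_)

open import Data.Bool using (T)
open import Data.Empty using (⊥; ⊥-elim)
open import Data.Fin using (_≟_)
open import Data.List using (List; []; _∷_; _++_; [_]; zip; map; length; filter; allFin)
open import Data.List.Properties using (++-assoc; filter-notAll)
import Data.List.Extrema
open import Data.List.Membership.Propositional using (_∈_; _∉_)
open import Data.List.Membership.Propositional.Properties
  using (∈-filter⁺; ∈-filter⁻; ∈-allFin; ∈-∃++)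
open import Data.List.Relation.Unary.All as All using (All; []; _∷_)
open import Data.List.Relation.Unary.AllPairs using (_∷_)
open import Data.List.Relation.Unary.Any as Any using (here; there)
open import Data.List.Relation.Unary.Any.Properties using (¬Any[])
open import Data.List.Relation.Unary.Linked as Linked using (Linked)
open import Data.List.Relation.Unary.Linked.Properties using (Linked⇒All)
open import Data.List.Relation.Unary.Unique.Propositional using (Unique)
open import Data.List.Relation.Unary.Unique.Propositional.Properties
  using (filter⁺; allFin⁺; Unique[x∷xs]⇒x∉xs)
open import Data.List.Relation.Binary.Permutation.Propositional using (_↭_; ↭-refl; ↭-sym; ↭⇒↭ₛ)
open import Data.List.Relation.Binary.Permutation.Propositional.Properties
  using (All-resp-↭; ∈-resp-↭; ↭-length; ++-comm; map⁺; ∷↭∷ʳ)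
import Data.List.Relation.Binary.Permutation.Setoid.Properties as Setoid↭
import Data.List.Sort
open import Data.Maybe using (Maybe; just; nothing; fromMaybe; is-nothing)
open import Data.Maybe.Properties using (just-injective; ≡-dec)
open import Data.Nat as ℕ using (ℕ; suc; z≤n; s≤s)
import Data.Nat.Properties as ℕ
open import Data.Nat.Induction using (<-wellFounded)
open import Data.Product using (_,_; proj₁; proj₂; uncurry)
open import Data.Rational using (_<_; _≤?_)
import Data.Rational.Properties as ℚ
open import Data.Sum using (_⊎_; inj₁; inj₂)
open import Data.Unit using (tt)
open import Function.Bundles using (mk⇔; Equivalence)
open import Induction.WellFounded using (Acc; acc)
open import Level using (0ℓ)
open import Relation.Binary.Bundles using (DecTotalOrder)
import Relation.Binary.Construct.On as On
open import Relation.Binary.PropositionalEquality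
  using (_≡_; _≢_; refl; sym; trans; cong; subst; subst₂; setoid; module ≡-Reasoning)
open import Relation.Nullary using (¬_; ¬?; Dec; yes; no)
open import Relation.Nullary.Decidable using (dec-true; dec-false; T?; _×-dec_)
open import Relation.Unary using (Pred; Decidable; _⊆_)

-- Put t = dist(s,C) + w(C).  Every run of HBD(G,s,t) is finite, and a run that
-- does not report a cycle ends with an empty queue.  In that final state every
-- labelled vertex y has followed each edge yz with d(y) + w(yz) ≤ t without
-- meeting a labelled vertex, so yz is a tree edge: one endpoint was discovered
-- through the other.  Following a shortest walk from s to C and then going once
-- around C never exceeds the budget t, so every edge of C is a tree edge.  But
-- the tree edges form a forest (depth increases from parent to child),
-- and a forest contains no cycle.

<⇒≱ : ∀ {p q} → p < q → ¬ q ≤ p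
<⇒≱ p<q q≤p = ℚ.<-irrefl refl (ℚ.<-≤-trans p<q q≤p)

p≤p+q : ∀ {p q} → 0ℚ ≤ q → p ≤ p + q
p≤p+q {p} {q} 0≤q = subst (_≤ p + q) (ℚ.+-identityʳ p) (ℚ.+-monoʳ-≤ p 0≤q)

nonneg+nonneg : ∀ {p q} → 0ℚ ≤ p → 0ℚ ≤ q → 0ℚ ≤ p + q
nonneg+nonneg 0≤p 0≤q = ℚ.≤-trans 0≤p (p≤p+q 0≤q)

≤-+-assoc : ∀ {p} q r s → p ≤ q + r → p + s ≤ q + (r + s)
≤-+-assoc q r s p≤q+r = ℚ.≤-trans (ℚ.+-monoˡ-≤ s p≤q+r) (ℚ.≤-reflexive (ℚ.+-assoc q r s))

prefix-≤ : ∀ p q {r t} → 0ℚ ≤ r → p + (q + r) ≤ t → p + q ≤ t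
prefix-≤ p q 0≤r = ℚ.≤-trans (ℚ.+-monoʳ-≤ p (p≤p+q 0≤r))

suc-double-< : ∀ {a b} → a ℕ.< b → suc (2 ℕ.* a) ℕ.< 2 ℕ.* b
suc-double-< {a} {suc b} (s≤s a≤b) =
  s≤s (subst (suc (2 ℕ.* a) ℕ.≤_) (sym (ℕ.+-suc b (b ℕ.+ 0))) (s≤s (ℕ.*-monoʳ-≤ 2 a≤b)))

update-same : ∀ {n} {A : Set} (f : Fin n → A) v a → update f v a v ≡ a
update-same f v a rewrite dec-true (v ≟ v) refl = refl

update-other : ∀ {n} {A : Set} (f : Fin n → A) v a {y} → y ≢ v → update f v a y ≡ f y
update-other f v a {y} y≢v rewrite dec-false (y ≟ v) y≢v = refl

just≢nothing : ∀ {A : Set} {a : A} → just a ≢ nothing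
just≢nothing ()

just-unique : ∀ {A : Set} {m : Maybe A} {a b} → m ≡ just a → m ≡ just b → a ≡ b
just-unique p q = just-injective (trans (sym p) q)

Unique-resp-↭ : ∀ {A : Set} {xs ys : List A} → xs ↭ ys → Unique xs → Unique ys
Unique-resp-↭ {A} p = Setoid↭.Unique-resp-↭ (setoid A) (↭⇒↭ₛ p)

module _ {A : Set} {P Q : Pred A 0ℓ} (P? : Decidable P) (Q? : Decidable Q) (P⊆Q : P ⊆ Q) where

  length-filter-mono : ∀ xs → length (filter P? xs) ℕ.≤ length (filter Q? xs)
  length-filter-mono []       = z≤n
  length-filter-mono (x ∷ xs) with P? x | Q? x
  ... | yes _  | yes _  = s≤s (length-filter-mono xs)
  ... | yes px | no ¬qx = ⊥-elim (¬qx (P⊆Q px))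
  ... | no _   | yes _  = ℕ.m≤n⇒m≤1+n (length-filter-mono xs)
  ... | no _   | no _   = length-filter-mono xs

  length-filter-< : ∀ {v xs} → v ∈ xs → ¬ P v → Q v →
                    length (filter P? xs) ℕ.< length (filter Q? xs)
  length-filter-< {xs = x ∷ xs} (here refl) ¬pv qv with P? x | Q? x
  ... | yes px | _      = ⊥-elim (¬pv px)
  ... | no _   | yes _  = s≤s (length-filter-mono xs)
  ... | no _   | no ¬qx = ⊥-elim (¬qx qv)
  length-filter-< {xs = x ∷ xs} (there v∈) ¬pv qv with P? x | Q? x
  ... | yes _  | yes _  = s≤s (length-filter-< v∈ ¬pv qv)
  ... | yes px | no ¬qx = ⊥-elim (¬qx (P⊆Q px))
  ... | no _   | yes _  = ℕ.m≤n⇒m≤1+n (length-filter-< v∈ ¬pv qv)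
  ... | no _   | no _   = length-filter-< v∈ ¬pv qv

module _ {A : Set} where

  pathPairs : A → List A → List (A × A)
  pathPairs y []       = []
  pathPairs y (z ∷ zs) = (y , z) ∷ pathPairs z zs

  zip-pathPairs : ∀ y zs e → zip (y ∷ zs) (zs ++ [ e ]) ≡ pathPairs y (zs ++ [ e ])
  zip-pathPairs y []       e = refl
  zip-pathPairs y (z ∷ zs) e = cong ((y , z) ∷_) (zip-pathPairs z zs e)

  pathPairs-++ : ∀ y zs w ws → pathPairs y (zs ++ w ∷ ws) ≡ pathPairs y (zs ++ [ w ]) ++ pathPairs w ws
  pathPairs-++ y []       w ws = refl
  pathPairs-++ y (z ∷ zs) w ws = cong ((y , z) ∷_) (pathPairs-++ z zs w ws)

  cyclePairs-split : ∀ a as b bs →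
    cyclePairs (a ∷ as ++ b ∷ bs) ≡ pathPairs a (as ++ [ b ]) ++ pathPairs b (bs ++ [ a ])
  cyclePairs-split a as b bs = begin
    cyclePairs (a ∷ as ++ b ∷ bs)                    ≡⟨ zip-pathPairs a (as ++ b ∷ bs) a ⟩
    pathPairs a ((as ++ b ∷ bs) ++ [ a ])            ≡⟨ cong (pathPairs a) (++-assoc as (b ∷ bs) [ a ]) ⟩
    pathPairs a (as ++ b ∷ bs ++ [ a ])              ≡⟨ pathPairs-++ a as b (bs ++ [ a ]) ⟩
    pathPairs a (as ++ [ b ]) ++ pathPairs b (bs ++ [ a ]) ∎
    where open ≡-Reasoning

  cyclePairs-rotate : ∀ a as b bs → cyclePairs (a ∷ as ++ b ∷ bs) ↭ cyclePairs (b ∷ bs ++ a ∷ as)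
  cyclePairs-rotate a as b bs
    rewrite cyclePairs-split a as b bs | cyclePairs-split b bs a as =
    ++-comm (pathPairs a (as ++ [ b ])) (pathPairs b (bs ++ [ a ]))

  cycle-rotation : ∀ {x xs} → x ∈ xs → ∃[ ys ] (x ∷ ys ↭ xs × cyclePairs (x ∷ ys) ↭ cyclePairs xs)
  cycle-rotation x∈ with ∈-∃++ x∈
  ... | []     , bs , refl = bs , ↭-refl , ↭-refl
  ... | a ∷ as , bs , refl = bs ++ a ∷ as , ++-comm (_ ∷ bs) (a ∷ as) , cyclePairs-rotate _ bs a as

TreeEdge : ∀ {A : Set} → (A → Maybe A) → A → A → Set
TreeEdge parent a b = parent b ≡ just a ⊎ parent a ≡ just b

module RankedForest {A : Set} (parent : A → Maybe A) (rank : A → ℕ)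
                    (rank-parent  : ∀ {y u} → parent y ≡ just u → rank u ℕ.< rank y) where

  -- NonBacktracking a b d e: a walk along tree edges whose first edge is ab and
  -- whose last edge is de, and which never returns to the vertex it just left.
  data NonBacktracking : A → A → A → A → Set where
    edge   : ∀ {a b} → TreeEdge parent a b → NonBacktracking a b a b
    _∷⟨_⟩_ : ∀ {a b c d e} → TreeEdge parent a b → a ≢ c → NonBacktracking b c d e →
             NonBacktracking a b d e

  first-edge : ∀ {a b d e} → NonBacktracking a b d e → TreeEdge parent a b
  first-edge (edge ab)    = ab
  first-edge (ab ∷⟨ _ ⟩ _) = ab

  last-edge : ∀ {a b d e} → NonBacktracking a b d e → TreeEdge parent d e
  last-edge (edge ab)    = ab
  last-edge (_ ∷⟨ _ ⟩ w) = last-edge w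

  -- Once the walk steps down from a parent to its child it can never turn back up:
  -- that child would need a second parent.
  ascending : ∀ {a b d e} → NonBacktracking a b d e → parent b ≡ just a → rank a ℕ.< rank e
  ascending (edge _)       pb = rank-parent pb
  ascending (_ ∷⟨ a≢c ⟩ w) pb with first-edge w
  ... | inj₁ pc  = ℕ.<-trans (rank-parent pb) (ascending w pc)
  ... | inj₂ pb′ = ⊥-elim (a≢c (just-unique pb pb′))

  descending : ∀ {a b d e} → NonBacktracking a b d e → parent d ≡ just e →
               parent a ≡ just b × rank e ℕ.< rank a
  descending (edge _)        pd = pd , rank-parent pd
  descending (ab ∷⟨ a≢c ⟩ w) pd with descending w pd | ab
  ... | pb , e<b | inj₁ pb′ = ⊥-elim (a≢c (just-unique pb′ pb))
  ... | pb , e<b | inj₂ pa  = pa , ℕ.<-trans e<b (rank-parent pa)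

  no-closed-walk : ∀ {a b d} → NonBacktracking a b d a → d ≢ b → ⊥
  no-closed-walk w d≢b with first-edge w
  ... | inj₁ pb = ℕ.<-irrefl refl (ascending w pb)
  ... | inj₂ pa with last-edge w
  ...   | inj₁ pa′ = d≢b (just-unique pa′ pa)
  ...   | inj₂ pd  = ℕ.<-irrefl refl (proj₂ (descending w pd))

  lastPair : A → A → List A → A × A
  lastPair y z []       = y , z
  lastPair y z (w ∷ ws) = lastPair z w ws

  lastPair-snoc : ∀ y z ws e → ∃[ d ] (lastPair y z (ws ++ [ e ]) ≡ (d , e) × d ∈ z ∷ ws)
  lastPair-snoc y z []       e = z , refl , here refl
  lastPair-snoc y z (w ∷ ws) e with lastPair-snoc z w ws e
  ... | d , eq , d∈ = d , eq , there d∈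

  nonBacktracking : ∀ {y z} ws → Unique (y ∷ z ∷ ws) →
                    All (uncurry (TreeEdge parent)) (pathPairs y (z ∷ ws)) →
                    NonBacktracking y z (proj₁ (lastPair y z ws)) (proj₂ (lastPair y z ws))
  nonBacktracking []       _                        (yz ∷ []) = edge yz
  nonBacktracking (w ∷ ws) ((_ ∷ y≢w ∷ _) ∷ unique) (yz ∷ tes) =
    yz ∷⟨ y≢w ⟩ nonBacktracking ws unique tes

  acyclic : ∀ {x rest} → Unique (x ∷ rest) → 3 ℕ.≤ length (x ∷ rest) →
            All (uncurry (TreeEdge parent)) (pathPairs x (rest ++ [ x ])) → ⊥
  acyclic {x} {r₁ ∷ r₂ ∷ rs} unique@((_ ∷ x≢r₂ ∷ _) ∷ unique-rest) _ (xr₁ ∷ tes)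
    with lastPair-snoc r₁ r₂ rs x
  ... | d , last≡ , d∈ = no-closed-walk (xr₁ ∷⟨ x≢r₂ ⟩ around) λ { refl → r₁∉ d∈ }
    where
    unique-around : Unique (r₁ ∷ r₂ ∷ rs ++ [ x ])
    unique-around = Unique-resp-↭ (∷↭∷ʳ x (r₁ ∷ r₂ ∷ rs)) unique
    around : NonBacktracking r₁ r₂ d x
    around = subst (λ p → NonBacktracking r₁ r₂ (proj₁ p) (proj₂ p)) last≡
                   (nonBacktracking (rs ++ [ x ]) unique-around tes)
    r₁∉ : r₁ ∉ r₂ ∷ rs
    r₁∉ = Unique[x∷xs]⇒x∉xs unique-rest
  acyclic {rest = []}     _ (s≤s ())       _
  acyclic {rest = _ ∷ []} _ (s≤s (s≤s ())) _

module _ {n : ℕ} (G : Graph n) where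

  wt-nonneg : ∀ x y → 0ℚ ≤ wt G x y
  wt-nonneg x y with W G x y in xy
  ... | just w  = nonneg G x y w xy
  ... | nothing = ℚ.≤-refl

  wt-edge : ∀ {x y w} → W G x y ≡ just w → wt G x y ≡ w
  wt-edge = cong (fromMaybe 0ℚ)

  walk-nonneg : ∀ {x y c} → Walk (W G) x y c → 0ℚ ≤ c
  walk-nonneg here                           = ℚ.≤-refl
  walk-nonneg (step {x} {y} {w = w} xy rest) = nonneg+nonneg (nonneg G x y w xy) (walk-nonneg rest)

  totalWeight : List (Fin n × Fin n) → ℚ
  totalWeight ps = sumℚ (map (uncurry (wt G)) ps)

  totalWeight-nonneg : ∀ ps → 0ℚ ≤ totalWeight ps
  totalWeight-nonneg []             = ℚ.≤-refl
  totalWeight-nonneg ((x , y) ∷ ps) = nonneg+nonneg (wt-nonneg x y) (totalWeight-nonneg ps)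

  totalWeight-↭ : ∀ {ps qs} → ps ↭ qs → totalWeight ps ≡ totalWeight qs
  totalWeight-↭ p =
    Setoid↭.foldr-commMonoid (setoid ℚ) ℚ.+-0-isCommutativeMonoid (↭⇒↭ₛ (map⁺ (uncurry (wt G)) p))

  record RootedCycle (x : Fin n) (w : ℚ) : Set where
    field
      rest     : List (Fin n)
      unique   : Unique (x ∷ rest)
      length≥3 : 3 ℕ.≤ length (x ∷ rest)
      edges    : All (uncurry (IsEdge G)) (pathPairs x (rest ++ [ x ]))
      weight   : totalWeight (pathPairs x (rest ++ [ x ])) ≡ w

  rootAt : ∀ (C : Cycle G) {x} → x ∈ verts C → RootedCycle x (cycleWeight C)
  rootAt C {x} x∈ with cycle-rotation x∈
  ... | ys , vertices↭ , pairs↭ = record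
    { rest     = ys
    ; unique   = Unique-resp-↭ (↭-sym vertices↭) (distinct C)
    ; length≥3 = subst (3 ℕ.≤_) (↭-length (↭-sym vertices↭)) (long C)
    ; edges    = subst (All (uncurry (IsEdge G))) (zip-pathPairs x ys x)
                       (All-resp-↭ (↭-sym pairs↭) (adjacent C))
    ; weight   = trans (cong totalWeight (sym (zip-pathPairs x ys x))) (totalWeight-↭ pairs↭)
    }

module HBD {n : ℕ} (G : Graph n) (s : Fin n) (t : ℚ) where

  Labelled : State n → Fin n → Set
  Labelled st y = ∃[ dy ] (d st y ≡ just dy)

  BeingScanned : State n → Fin n → Set
  BeingScanned st u = ∃[ L ] (scan st ≡ just (u , L))

  Covered : State n → Fin n → List (Fin n) → Set
  Covered st u L = ∀ {du z} → d st u ≡ just du → IsEdge G u z → du + wt G u z ≤ t →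
                   TreeEdge (par st) u z ⊎ z ∈ L

  Finished : State n → Fin n → Set
  Finished st y = ∀ {dy z} → d st y ≡ just dy → IsEdge G y z → dy + wt G y z ≤ t →
                  TreeEdge (par st) y z

  Status : State n → Fin n → Set
  Status st y = y ∈ Q st ⊎ BeingScanned st y ⊎ Finished st y

  SortedBy : Fin n → List (Fin n) → Set
  SortedBy u = Linked (λ a b → wt G u a ≤ wt G u b)

  -- rank is ghost state witnessing that the parent pointers form a forest
  record Invariant (st : State n) : Set where
    field
      rank         : Fin n → ℕ
      source       : d st s ≡ just 0ℚ
      queued       : ∀ {v} → v ∈ Q st → Labelled st v
      parent-label : ∀ {y u} → par st y ≡ just u →
                     ∃[ du ] (d st u ≡ just du × d st y ≡ just (du + wt G u y))
      rank-parent  : ∀ {y u} → par st y ≡ just u → rank u ℕ.< rank y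
      scanning     : ∀ {u L} → scan st ≡ just (u , L) → Labelled st u × SortedBy u L × Covered st u L
      status       : ∀ {y} → Labelled st y → Status st y
  open Invariant

  Exhausted : State n → Set
  Exhausted st = scan st ≡ nothing × Q st ≡ []

  initial-invariant : Invariant (initState s)
  initial-invariant = record
    { rank         = λ _ → 0
    ; source       = source-label
    ; queued       = λ { (here refl) → 0ℚ , source-label }
    ; parent-label = λ ()
    ; rank-parent  = λ ()
    ; scanning     = λ ()
    ; status       = λ {y} lab → inj₁ (here (only-source lab))
    }
    where
    source-label : d (initState s) s ≡ just 0ℚ
    source-label = update-same (λ _ → nothing) s (just 0ℚ)
    only-source : ∀ {y} → Labelled (initState s) y → y ≡ s
    only-source {y} (_ , dy) with y ≟ s
    ... | yes y≡s = y≡s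
    ... | no _    = ⊥-elim (just≢nothing (sym dy))

  startScan : State n → Fin n → List (Fin n) → State n
  startScan st u L = mkState (d st) (par st) (filter (λ y → ¬? (y ≟ u)) (Q st)) (just (u , L))

  endScan : State n → State n
  endScan st = mkState (d st) (par st) (Q st) nothing

  discover : State n → Fin n → Fin n → ℚ → List (Fin n) → State n
  discover st u v dv L =
    mkState (update (d st) v (just dv)) (update (par st) v (just u)) (v ∷ Q st) (just (u , L))

  startScan-invariant : ∀ {st u du L} → Invariant st → scan st ≡ nothing → d st u ≡ just du →
                        ScanList G t st u L → Invariant (startScan st u L)
  startScan-invariant {st} {u} {du} {L} I idle du-eq (_ , neighbours , sorted) = record
    { rank         = rank I
    ; source       = source I
    ; queued       = λ v∈ → queued I (proj₁ (∈-filter⁻ (λ y → ¬? (y ≟ u)) v∈))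
    ; parent-label = parent-label I
    ; rank-parent  = rank-parent I
    ; scanning     = λ { refl → (du , du-eq) , sorted , covered }
    ; status       = status′
    }
    where
    covered : Covered st u L
    covered {z = z} _ uz _ with ≡-dec _≟_ (par st u) (just z)
    ... | yes pu = inj₁ (inj₂ pu)
    ... | no ¬pu = inj₂ (Equivalence.from (neighbours z) (uz , ¬pu))
    status′ : ∀ {y} → Labelled st y → Status (startScan st u L) y
    status′ {y} lab with status I lab | y ≟ u
    ... | inj₁ _            | yes refl = inj₂ (inj₁ (L , refl))
    ... | inj₁ y∈           | no y≢u   = inj₁ (∈-filter⁺ (λ y → ¬? (y ≟ u)) y∈ y≢u)
    ... | inj₂ (inj₁ (_ , sc)) | _      = ⊥-elim (just≢nothing (trans (sym sc) idle))
    ... | inj₂ (inj₂ fin)   | _        = inj₂ (inj₂ fin)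

  endScan-invariant : ∀ {st u L} → Invariant st → scan st ≡ just (u , L) →
                      (∀ {du z} → d st u ≡ just du → z ∈ L → t < du + wt G u z) →
                      Invariant (endScan st)
  endScan-invariant {st} {u} {L} I sc beyond = record
    { rank         = rank I
    ; source       = source I
    ; queued       = queued I
    ; parent-label = parent-label I
    ; rank-parent  = rank-parent I
    ; scanning     = λ ()
    ; status       = status′
    }
    where
    finished : Finished st u
    finished du-eq uz within with proj₂ (proj₂ (scanning I sc)) du-eq uz within
    ... | inj₁ tree = tree
    ... | inj₂ z∈   = ⊥-elim (<⇒≱ (beyond du-eq z∈) within)
    status′ : ∀ {y} → Labelled st y → Status (endScan st) y
    status′ lab with status I lab
    ... | inj₁ y∈               = inj₁ y∈
    ... | inj₂ (inj₂ fin)       = inj₂ (inj₂ fin)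
    ... | inj₂ (inj₁ (_ , sc′)) with trans (sym sc) sc′
    ...   | refl = inj₂ (inj₂ finished)

  -- the scan list is sorted, so its first edge is the lightest one
  beyond-threshold : ∀ {st u v L du} → Invariant st → scan st ≡ just (u , v ∷ L) →
                     d st u ≡ just du → t < du + wt G u v →
                     ∀ {du′ z} → d st u ≡ just du′ → z ∈ v ∷ L → t < du′ + wt G u z
  beyond-threshold {u = u} {v} {du = du} I sc du-eq over du′-eq z∈
    rewrite just-unique du′-eq du-eq =
    ℚ.<-≤-trans over (ℚ.+-monoʳ-≤ du (All.lookup (Linked⇒All ℚ.≤-trans ℚ.≤-refl sorted) z∈))
    where
    sorted : SortedBy u (v ∷ _)
    sorted = proj₁ (proj₂ (scanning I sc))

  module Discover {st u v du L} (I : Invariant st) (sc : scan st ≡ just (u , v ∷ L))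
                  (du-eq : d st u ≡ just du) (fresh : d st v ≡ nothing) where

    st′ : State n
    st′ = discover st u v (du + wt G u v) L

    labelled≢v : ∀ {y} → Labelled st y → y ≢ v
    labelled≢v (_ , dy) refl = just≢nothing (trans (sym dy) fresh)

    d-other : ∀ {y} → y ≢ v → d st′ y ≡ d st y
    d-other = update-other (d st) v (just (du + wt G u v))

    par-other : ∀ {y} → y ≢ v → par st′ y ≡ par st y
    par-other = update-other (par st) v (just u)

    labelled-kept : ∀ {y} → Labelled st y → Labelled st′ y
    labelled-kept (dy , dy-eq) = dy , trans (d-other (labelled≢v (dy , dy-eq))) dy-eq

    parent-labelled : ∀ {y b} → par st y ≡ just b → Labelled st b
    parent-labelled p with parent-label I p
    ... | db , db-eq , _ = db , db-eq

    child-labelled : ∀ {y b} → par st y ≡ just b → Labelled st y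
    child-labelled p with parent-label I p
    ... | _ , _ , dy-eq = _ , dy-eq

    treeEdge-kept : ∀ {a b} → TreeEdge (par st) a b → TreeEdge (par st′) a b
    treeEdge-kept (inj₁ pb) = inj₁ (trans (par-other (labelled≢v (child-labelled pb))) pb)
    treeEdge-kept (inj₂ pa) = inj₂ (trans (par-other (labelled≢v (child-labelled pa))) pa)

    parent-cases : ∀ {y b} → par st′ y ≡ just b →
                   (y ≡ v × b ≡ u) ⊎ (y ≢ v × par st y ≡ just b)
    parent-cases {y} {b} p = cases (y ≟ v)
      where
      cases : Dec (y ≡ v) → (y ≡ v × b ≡ u) ⊎ (y ≢ v × par st y ≡ just b)
      cases (yes refl) = inj₁ (refl , just-unique p (update-same (par st) v (just u)))
      cases (no y≢v)   = inj₂ (y≢v , trans (sym (par-other y≢v)) p)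

    finished-kept : ∀ {y} → y ≢ v → Finished st y → Finished st′ y
    finished-kept y≢v fin dy-eq yz within = treeEdge-kept (fin (trans (sym (d-other y≢v)) dy-eq) yz within)

    rank′ : Fin n → ℕ
    rank′ = update (rank I) v (suc (rank I u))

    rank-other : ∀ {y} → y ≢ v → rank′ y ≡ rank I y
    rank-other = update-other (rank I) v (suc (rank I u))

    rank-fresh : rank′ v ≡ suc (rank I u)
    rank-fresh = update-same (rank I) v (suc (rank I u))

    u≢v : u ≢ v
    u≢v = labelled≢v (du , du-eq)

    invariant : Invariant st′
    invariant .rank = rank′
    invariant .source = trans (d-other (labelled≢v (0ℚ , source I))) (source I)
    invariant .queued (here refl) = _ , update-same (d st) v (just (du + wt G u v))
    invariant .queued (there w∈)  = labelled-kept (queued I w∈)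
    invariant .parent-label p with parent-cases p
    ... | inj₁ (refl , refl) = du , trans (d-other u≢v) du-eq , update-same (d st) v _
    ... | inj₂ (y≢v , p′) with parent-label I p′
    ...   | db , db-eq , dy-eq = db , proj₂ (labelled-kept (db , db-eq)) , trans (d-other y≢v) dy-eq
    invariant .rank-parent p with parent-cases p
    ... | inj₁ (refl , refl) = subst₂ ℕ._<_ (sym (rank-other u≢v)) (sym rank-fresh) (ℕ.n<1+n (rank I u))
    ... | inj₂ (y≢v , p′) =
      subst₂ ℕ._<_ (sym (rank-other (labelled≢v (parent-labelled p′)))) (sym (rank-other y≢v))
                   (rank-parent I p′)
    invariant .scanning refl with scanning I sc
    ... | _ , sorted , covered = labelled-kept (du , du-eq) , Linked.tail sorted , covered′
      where
      covered′ : Covered st′ u L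
      covered′ du′-eq uz within with covered (trans (sym (d-other u≢v)) du′-eq) uz within
      ... | inj₁ tree        = inj₁ (treeEdge-kept tree)
      ... | inj₂ (here refl) = inj₁ (inj₁ (update-same (par st) v (just u)))
      ... | inj₂ (there z∈)  = inj₂ z∈
    invariant .status {y} (dy , dy-eq) = status-cases (y ≟ v)
      where
      status-cases : Dec (y ≡ v) → Status st′ y
      status-cases (yes refl) = inj₁ (here refl)
      status-cases (no y≢v) with status I (dy , trans (sym (d-other y≢v)) dy-eq)
      ... | inj₁ y∈         = inj₁ (there y∈)
      ... | inj₂ (inj₂ fin) = inj₂ (inj₂ (finished-kept y≢v fin))
      ... | inj₂ (inj₁ (_ , sc′)) with trans (sym sc) sc′
      ...   | refl = inj₂ (inj₁ (L , refl))

  invariant-preserved : ∀ {st st′} → Invariant st → Step G t st (running st′) → Invariant st′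
  invariant-preserved I (extract idle _ du-eq _ scanList) = startScan-invariant I idle du-eq scanList
  invariant-preserved I (scanDone sc)            = endScan-invariant I sc λ _ ()
  invariant-preserved I (scanStop sc du-eq over) = endScan-invariant I sc (beyond-threshold I sc du-eq over)
  invariant-preserved I (scanNew sc du-eq _ fresh) = Discover.invariant I sc du-eq fresh

  unlabelled : (Fin n → Maybe ℚ) → ℕ
  unlabelled dist = length (filter (λ y → T? (is-nothing (dist y))) (allFin n))

  unlabelled-decreases : ∀ {dist v} a → dist v ≡ nothing →
                         unlabelled (update dist v (just a)) ℕ.< unlabelled dist
  unlabelled-decreases {dist} {v} a fresh =
    length-filter-< _ _ still-unlabelled (∈-allFin v) labelled-now was-unlabelled
    where
    still-unlabelled : ∀ {y} → T (is-nothing (update dist v (just a) y)) → T (is-nothing (dist y))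
    still-unlabelled {y} with y ≟ v
    ... | yes _ = λ ()
    ... | no _  = λ unl → unl
    labelled-now : ¬ T (is-nothing (update dist v (just a) v))
    labelled-now rewrite update-same dist v (just a) = λ ()
    was-unlabelled : T (is-nothing (dist v))
    was-unlabelled rewrite fresh = tt

  scanFlag : Maybe (Fin n × List (Fin n)) → ℕ
  scanFlag nothing  = 0
  scanFlag (just _) = 1

  -- lexicographic in (unlabelled vertices, queue length, scan in progress)
  measure : State n → ℕ
  measure st = scanFlag (scan st) ℕ.+ 2 ℕ.* (length (Q st) ℕ.+ 2 ℕ.* unlabelled (d st))

  measure-decreases : ∀ {st st′} → Step G t st (running st′) → measure st′ ℕ.< measure st
  measure-decreases {st} (extract {u = u} idle u∈ _ _ _) rewrite idle =
    suc-double-< (ℕ.+-monoˡ-< (2 ℕ.* unlabelled (d st)) queue-shrinks)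
    where
    queue-shrinks : length (filter (λ y → ¬? (y ≟ u)) (Q st)) ℕ.< length (Q st)
    queue-shrinks = filter-notAll (λ y → ¬? (y ≟ u)) (Q st) (Any.map (λ u≡y y≢u → y≢u (sym u≡y)) u∈)
  measure-decreases (scanDone sc)     rewrite sc = ℕ.n<1+n _
  measure-decreases (scanStop sc _ _) rewrite sc = ℕ.n<1+n _
  measure-decreases {st} (scanNew {u = u} {v} {du = du} sc _ _ fresh) rewrite sc =
    s≤s (ℕ.*-monoʳ-< 2 (begin-strict
      suc (length (Q st)) ℕ.+ 2 ℕ.* unlabelled d′ ≡⟨ ℕ.+-suc (length (Q st)) _ ⟨
      length (Q st) ℕ.+ suc (2 ℕ.* unlabelled d′) <⟨ ℕ.+-monoʳ-< (length (Q st)) fewer-unlabelled ⟩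
      length (Q st) ℕ.+ 2 ℕ.* unlabelled (d st)   ∎))
    where
    open ℕ.≤-Reasoning
    d′ = update (d st) v (just (du + wt G u v))
    fewer-unlabelled : suc (2 ℕ.* unlabelled d′) ℕ.< 2 ℕ.* unlabelled (d st)
    fewer-unlabelled = suc-double-< (unlabelled-decreases _ fresh)

  sortedNeighbours : ∀ st u → ∃[ L ] ScanList G t st u L
  sortedNeighbours st u =
    sort candidates , unique , (λ v → mk⇔ (sound v) (complete v)) , sort-↗ candidates
    where
    open Data.List.Sort (On.decTotalOrder ℚ.≤-decTotalOrder (wt G u))
    candidate? : ∀ v → Dec (IsEdge G u v × par st u ≢ just v)
    candidate? v = isEdge? ×-dec ¬? (≡-dec _≟_ (par st u) (just v))
      where
      isEdge? : Dec (IsEdge G u v)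
      isEdge? with W G u v
      ... | just w  = yes (w , refl)
      ... | nothing = no λ ()
    candidates = filter candidate? (allFin n)
    unique : Unique (sort candidates)
    unique = Unique-resp-↭ (↭-sym (sort-↭ candidates)) (filter⁺ candidate? (allFin⁺ n))
    sound : ∀ v → v ∈ sort candidates → IsEdge G u v × par st u ≢ just v
    sound v v∈ = proj₂ (∈-filter⁻ candidate? {xs = allFin n} (∈-resp-↭ (sort-↭ candidates) v∈))
    complete : ∀ v → IsEdge G u v × par st u ≢ just v → v ∈ sort candidates
    complete v cand = ∈-resp-↭ (↭-sym (sort-↭ candidates)) (∈-filter⁺ candidate? (∈-allFin v) cand)

  nearest : ∀ st {q qs} → (∀ {v} → v ∈ q ∷ qs → Labelled st v) →
            ∃[ u ] ∃[ du ] (u ∈ q ∷ qs × d st u ≡ just du ×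
                           (∀ v → v ∈ q ∷ qs → ∃[ dv ] (d st v ≡ just dv × du ≤ dv)))
  nearest st {q} {qs} labelled =
    u , label u , u∈ , label-correct u∈ , λ v v∈ → label v , label-correct v∈ , minimal v∈
    where
    open Data.List.Extrema (DecTotalOrder.totalOrder ℚ.≤-decTotalOrder)
    -- the junk value 0 is never used: all candidates are labelled
    label : Fin n → ℚ
    label v = fromMaybe 0ℚ (d st v)
    u : Fin n
    u = argmin label q qs
    label-correct : ∀ {v} → v ∈ q ∷ qs → d st v ≡ just (label v)
    label-correct v∈ with labelled v∈
    ... | _ , dv rewrite dv = refl
    u∈ : u ∈ q ∷ qs
    u∈ with argmin-sel label q qs
    ... | inj₁ u≡q  = here u≡q
    ... | inj₂ u∈qs = there u∈qs
    minimal : ∀ {v} → v ∈ q ∷ qs → label u ≤ label v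
    minimal (here refl) = f[argmin]≤f[⊤] {f = label} q qs
    minimal (there v∈)  = All.lookup (f[argmin]≤f[xs] {f = label} q qs) v∈

  progress : ∀ {st} → Invariant st → ¬ Exhausted st → ∃[ c ] Step G t st c
  progress {mkState _ _ [] nothing} _ not-exhausted = ⊥-elim (not-exhausted (refl , refl))
  progress {st@(mkState _ _ (_ ∷ _) nothing)} I _ with nearest st (queued I)
  ... | u , _ , u∈ , du-eq , minimal = _ , extract refl u∈ du-eq minimal (proj₂ (sortedNeighbours st u))
  progress {mkState _ _ _ (just (_ , []))} _ _ = _ , scanDone refl
  progress {st@(mkState _ _ _ (just (u , v ∷ _)))} I _ with proj₁ (scanning I refl)
  ... | du , du-eq with du + wt G u v ≤? t
  ...   | no over = _ , scanStop refl du-eq (ℚ.≰⇒> over)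
  ...   | yes within with d st v in dv
  ...     | just _  = _ , scanReport refl du-eq within dv
  ...     | nothing = _ , scanNew refl du-eq within dv

  treeEdge-label : ∀ {st y z dy} → Invariant st → TreeEdge (par st) y z → d st y ≡ just dy →
                   ∃[ dz ] (d st z ≡ just dz × dz ≤ dy + wt G y z)
  treeEdge-label I (inj₁ pz) dy-eq with parent-label I pz
  ... | _ , dy-eq′ , dz-eq rewrite just-unique dy-eq dy-eq′ = _ , dz-eq , ℚ.≤-refl
  treeEdge-label {y = y} {z} I (inj₂ py) dy-eq with parent-label I py
  ... | dz , dz-eq , dy-eq′ rewrite just-unique dy-eq dy-eq′ =
    dz , dz-eq , ℚ.≤-trans (p≤p+q (wt-nonneg G z y)) (p≤p+q (wt-nonneg G y z))

  module AtExhaustion {st} (I : Invariant st) (exhausted : Exhausted st) where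

    finished : ∀ {y} → Labelled st y → Finished st y
    finished lab with status I lab
    ... | inj₁ y∈              = ⊥-elim (¬Any[] (subst (_ ∈_) (proj₂ exhausted) y∈))
    ... | inj₂ (inj₁ (_ , sc)) = ⊥-elim (just≢nothing (trans (sym sc) (proj₁ exhausted)))
    ... | inj₂ (inj₂ fin)      = fin

    tree-step : ∀ {y z dy} → d st y ≡ just dy → IsEdge G y z → dy + wt G y z ≤ t →
                TreeEdge (par st) y z × ∃[ dz ] (d st z ≡ just dz × dz ≤ dy + wt G y z)
    tree-step dy-eq yz within = tree , treeEdge-label I tree dy-eq
      where tree = finished (_ , dy-eq) dy-eq yz within

    edge-step : ∀ {y z w dy} → d st y ≡ just dy → W G y z ≡ just w → dy + w ≤ t →
                ∃[ dz ] (d st z ≡ just dz × dz ≤ dy + w)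
    edge-step {dy = dy} dy-eq yz within
      with tree-step dy-eq (_ , yz) (subst (λ w → dy + w ≤ t) (sym (wt-edge G yz)) within)
    ... | _ , dz , dz-eq , dz≤ = dz , dz-eq , subst (λ w → dz ≤ dy + w) (wt-edge G yz) dz≤

    walk-labelled : ∀ {y z c dy} → Walk (W G) y z c → d st y ≡ just dy → dy + c ≤ t →
                    ∃[ dz ] (d st z ≡ just dz × dz ≤ dy + c)
    walk-labelled here dy-eq _ = _ , dy-eq , p≤p+q ℚ.≤-refl
    walk-labelled {dy = dy} (step {w = w} {c = c} yy′ rest) dy-eq within
      with edge-step dy-eq yy′ (prefix-≤ dy w (walk-nonneg G rest) within)
    ... | dy′ , dy′-eq , dy′≤ =
      let bound            = ≤-+-assoc dy w c dy′≤
          dz , dz-eq , dz≤ = walk-labelled rest dy′-eq (ℚ.≤-trans bound within)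
      in  dz , dz-eq , ℚ.≤-trans dz≤ bound

    path-tree : ∀ {y dy} zs → d st y ≡ just dy → All (uncurry (IsEdge G)) (pathPairs y zs) →
                dy + totalWeight G (pathPairs y zs) ≤ t → All (uncurry (TreeEdge (par st))) (pathPairs y zs)
    path-tree []       _     _            _      = []
    path-tree {y} {dy} (z ∷ zs) dy-eq (yz ∷ edges) within
      with tree-step dy-eq yz (prefix-≤ dy (wt G y z) (totalWeight-nonneg G (pathPairs z zs)) within)
    ... | tree , _ , dz-eq , dz≤ =
      tree ∷ path-tree zs dz-eq edges (ℚ.≤-trans (≤-+-assoc dy (wt G y z) _ dz≤) within)

  never-exhausted : ∀ {x w δ} → RootedCycle G x w → Walk (W G) s x δ → δ + w ≤ t →
                    ∀ {st} → Invariant st → ¬ Exhausted st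
  never-exhausted {x} {w} {δ} C walk budget {st} I exhausted =
    around (walk-labelled walk (source I) reach-budget)
    where
    open AtExhaustion I exhausted
    open RankedForest (par st) (rank I) (rank-parent I)
    open RootedCycle C
    open ℚ.≤-Reasoning
    w-nonneg : 0ℚ ≤ w
    w-nonneg = subst (0ℚ ≤_) weight (totalWeight-nonneg G (pathPairs x (rest ++ [ x ])))
    reach-budget : 0ℚ + δ ≤ t
    reach-budget = begin
      0ℚ + δ ≡⟨ ℚ.+-identityˡ δ ⟩
      δ      ≤⟨ p≤p+q w-nonneg ⟩
      δ + w  ≤⟨ budget ⟩
      t      ∎
    around : ∃[ dx ] (d st x ≡ just dx × dx ≤ 0ℚ + δ) → ⊥
    around (dx , dx-eq , dx≤) = acyclic unique length≥3 (path-tree (rest ++ [ x ]) dx-eq edges cycle-budget)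
      where
      cycle-budget : dx + totalWeight G (pathPairs x (rest ++ [ x ])) ≤ t
      cycle-budget = begin
        dx + totalWeight G (pathPairs x (rest ++ [ x ])) ≡⟨ cong (dx +_) weight ⟩
        dx + w                                           ≤⟨ ℚ.+-monoˡ-≤ w dx≤ ⟩
        0ℚ + δ + w                                       ≡⟨ cong (_+ w) (ℚ.+-identityˡ δ) ⟩
        δ + w                                            ≤⟨ budget ⟩
        t                                                ∎

  module _ (never-exhausted : ∀ {st} → Invariant st → ¬ Exhausted st) where

    always-reports : ∀ {st} → Invariant st → Acc ℕ._<_ (measure st) → AlwaysReports G t (running st)
    always-reports I (acc smaller) = next (progress I (never-exhausted I)) λ where
      reported      _      → done
      (running st′) st→st′ →
        always-reports (invariant-preserved I st→st′) (smaller (measure-decreases st→st′))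

    detects : HBDDetects G s t
    detects = always-reports initial-invariant (<-wellFounded _)

detects-cycle : ∀ {n} (G : Graph n) s (C : Cycle G) {x δ t} → x ∈ verts C → Walk (W G) s x δ →
                δ + cycleWeight C ≤ t → HBDDetects G s t
detects-cycle G s C x∈ walk budget =
  HBD.detects G s _ (HBD.never-exhausted G s _ (rootAt G C x∈) walk budget)

corollary1 : ∀ {n} (G : Graph n) (s : Fin n) (C : Cycle G) (δ : ℚ) →
    IsDistToCycle G s C δ →
    ∃[ t₀ ] (0ℚ ≤ t₀ × t₀ ≤ δ + cycleWeight C × HBDDetects G s t₀)
corollary1 G s C δ ((x , x∈ , walk) , _) =
  δ + cycleWeight C ,
  nonneg+nonneg (walk-nonneg G walk) (totalWeight-nonneg G (cyclePairs (verts C))) ,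
  ℚ.≤-refl ,
  detects-cycle G s C x∈ walk ℚ.≤-refl
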